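{- Let $n$ and $\ell$ be integers with $1\leq \ell\leq n$, and let $K_{n,n+\ell}$ be the complete bipartite graph with parts of sizes $n$ and $n+\ell$. Then $$\mathrm{va}_2^{\equiv}(K_{n,n+\ell})\leq 2\left\lfloor \frac{n+\ell+1}{3}\right\rfloor .$$ Moreover, the bound is sharp: there exist integers $n,\ell$ with $1\le \ell\le n$ for which equality holds.
   Context: All graphs are finite and simple. For a positive integer $t$, a $t$-coloring of a graph $G$ is any map $f:V(G)\to\{1,\dots,t\}$ (not necessarily proper), with color classes $V_i=f^{ -1}(i)$ (possibly empty). It is equitable if $||V_i|-|V_j||\le 1$ for all $i,j$. For a nonnegative integer $k$, a $(t,k)$-tree-coloring is a $t$-coloring such that every component of each induced subgraph $G[V_i]$ is a tree of maximum degree at most $k$ (i.e. each $G[V_i]$ is a forest of maximum degree at most $k$). An equitable $(t,k)$-tree-coloring is a $(t,k)$-tree-coloring that is equitable. The strong equitable vertex $k$-arboricity $\mathrm{va}_k^{\equiv}(G)$ is the smallest positive integer $t$ such that $G$ has an equitable $(t',k)$-tree-coloring for every integer $t'\ge t$. -}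

module Defs where

open import Data.Nat using (ℕ; zero; suc; _+_; _*_; _≤_; _/_)
open import Data.Bool using (Bool; true; false; _∧_)
open import Data.Fin using (Fin; zero; suc; toℕ; inject₁; fromℕ; _≟_)
open import Data.Fin.Properties using () renaming (_≟_ to _≟F_)
open import Data.List using (List; length; filter)
open import Data.List.Base using ()
open import Data.Vec.Functional using ()
open import Data.Product using (Σ; _×_; _,_)
open import Data.Nat.Properties using ()
open import Relation.Nullary using (¬_; Dec; yes; no)
open import Relation.Nullary.Decidable using (⌊_⌋)
open import Relation.Binary.PropositionalEquality using (_≡_)
open import Function.Definitions using (Injective)
open import Data.List using (allFin)

record Graph : Set where
  field
    order : ℕ
    adj   : Fin order → Fin order → Bool
    sym   : ∀ u v → adj u v ≡ adj v u
    irrefl : ∀ v → adj v v ≡ false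
open Graph public

-- Complete bipartite graph K_{a,b}: vertices i with toℕ i < a form the first
-- part (size a), the others the second part (size b).
inFirst : ∀ {N} → ℕ → Fin N → Bool
inFirst a i = ⌊ suc (toℕ i) Data.Nat.≤? a ⌋

xor : Bool → Bool → Bool
xor true true = false
xor true false = true
xor false true = true
xor false false = false

xor-comm : ∀ x y → xor x y ≡ xor y x
xor-comm true true = _≡_.refl
xor-comm true false = _≡_.refl
xor-comm false true = _≡_.refl
xor-comm false false = _≡_.refl

xor-self : ∀ x → xor x x ≡ false
xor-self true = _≡_.refl
xor-self false = _≡_.refl

K : ℕ → ℕ → Graph
K a b = record
  { order = a + b
  ; adj = λ u v → xor (inFirst a u) (inFirst a v)
  ; sym = λ u v → xor-comm (inFirst a u) (inFirst a v)
  ; irrefl = λ v → xor-self (inFirst a v)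
  }

module _ (G : Graph) where
  private
    N = order G

  -- A t-coloring (not necessarily proper).
  Coloring : ℕ → Set
  Coloring t = Fin N → Fin t

  classSize : ∀ {t} → Coloring t → Fin t → ℕ
  classSize f i = length (filter (λ v → f v ≟F i) (allFin N))

  Equitable : ∀ {t} → Coloring t → Set
  Equitable f = ∀ i j → classSize f i ≤ classSize f j + 1

  classDegree : ∀ {t} → Coloring t → Fin N → ℕ
  classDegree f v =
    length (filter (λ u → Data.Bool._≟_ (adj G v u ∧ ⌊ f u ≟F f v ⌋) true) (allFin N))

  -- A cycle of length m+3 in G: an injective cyclic sequence of vertices with
  -- consecutive vertices adjacent.
  record Cycle (m : ℕ) : Set where
    field
      vtx   : Fin (suc (suc (suc m))) → Fin N
      inj   : Injective _≡_ _≡_ vtx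
      step  : ∀ (i : Fin (suc (suc m))) → adj G (vtx (inject₁ i)) (vtx (suc i)) ≡ true
      close : adj G (vtx (fromℕ (suc (suc m)))) (vtx zero) ≡ true

  MonoCycle : ∀ {t} → Coloring t → Set
  MonoCycle {t} f = Σ ℕ λ m → Σ (Cycle m) λ C → Σ (Fin t) λ c →
                    ∀ i → f (Cycle.vtx C i) ≡ c

  TreeColoring : ∀ {t} → ℕ → Coloring t → Set
  TreeColoring k f = (¬ MonoCycle f) × (∀ v → classDegree f v ≤ k)

  HasEqTreeColoring : ℕ → ℕ → Set
  HasEqTreeColoring t k = Σ (Coloring t) λ f → Equitable f × TreeColoring k f

  StrongEq : ℕ → ℕ → Set
  StrongEq k t = ∀ t' → t ≤ t' → HasEqTreeColoring t' k

  -- t is the strong equitable vertex k-arboricity of G: the smallest positive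
  -- integer t with StrongEq k t.
  IsStrongEqVA : ℕ → ℕ → Set
  IsStrongEqVA k t = (1 ≤ t) × StrongEq k t × (∀ s → 1 ≤ s → StrongEq k s → t ≤ s)

bound : ℕ → ℕ → ℕ
bound n ℓ = 2 * ((n + ℓ + 1) / 3)

-- For t ≥ 2⌊(n+ℓ+1)/3⌋ we have 2n+ℓ ≤ 3t, except when n = 3M, ℓ = 1 and t = 2M.
-- In the main case color vertex v by v mod t: the classes differ in size by at most one and have
-- at most three vertices, so every class degree is at most 2; and there is no monochromatic cycle,
-- because a cycle of a bipartite graph needs two vertices on each side, i.e. four vertices
-- v₁ < v₂ < v₃ < v₄ in one residue class, forcing v₄ ≥ 3t. In the exceptional case color each side
-- by residues mod M with disjoint palettes: the classes (of sizes 3 and 4) are independent sets.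
-- The least t from which on such colorings exist can then be found by search, since the existence
-- of an equitable (t,2)-tree-coloring of K_{a,b} is decidable. For sharpness, K_{2,3} contains a
-- 4-cycle, so one color never suffices, while the bound for n = 2, ℓ = 1 is 2.

module Submission where

open import Data.Bool using (Bool; true; false; not; _∧_; if_then_else_)
import Data.Bool as Bool
open import Data.Bool.Properties using (∧-conicalˡ; ∧-conicalʳ; not-involutive; not-¬)
open import Data.Empty using (⊥-elim)
open import Data.Fin using (Fin; zero; suc; toℕ; fromℕ<; inject₁)
open import Data.Fin.Properties using (any?; all?; toℕ-fromℕ<; toℕ-injective; toℕ<n) renaming (_≟_ to _≟ᶠ_)
open import Data.List using ([]; _∷_; length; filter; tabulate; allFin)
open import Data.List.Membership.Propositional using (_∈_)
open import Data.List.Membership.Propositional.Properties using (∈-allFin)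
open import Data.List.Properties using (filter-accept; filter-reject; filter-≐; filter-none)
import Data.List.Relation.Unary.All as All
open import Data.List.Relation.Unary.Any using (here; there)
open import Data.Nat using (ℕ; zero; suc; _+_; _*_; _∸_; _≤_; _<_; _≡ᵇ_; _%_; _/_; z≤n; s≤s; z<s;
                            NonZero; >-nonZero; >-nonZero⁻¹)
open import Data.Nat.DivMod using (m%n<n; m≡m%n+[m/n]*n; m/n*n≤m; /-monoˡ-≤; m<n⇒m%n≡m; [m+n]%n≡m%n;
                                   m≥n⇒m/n>0)
open import Data.Nat.Properties
open import Data.Nat.Tactic.RingSolver using (solve-∀)
open import Data.Product using (Σ; ∃; ∃₂; _×_; _,_; proj₁; proj₂)
open import Data.Sum using (_⊎_; inj₁; inj₂)
import Data.Vec.Functional as Vector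
open import Function using (_∘_; case_of_)
open import Level using (0ℓ)
open import Relation.Binary.Definitions using (tri<; tri≈; tri>)
open import Relation.Binary.PropositionalEquality
open import Relation.Nullary using (¬_; Dec; yes; no; does; contradiction)
open import Relation.Nullary.Decidable using (_×-dec_; _→-dec_; ¬?; ⌊_⌋; map′; isYes≗does; dec-true; dec-false)
open import Relation.Unary using (Pred; Decidable; _⊆_)
open import Defs hiding (sym)

count : ℕ → (ℕ → Bool) → ℕ
count zero    p = 0
count (suc n) p = (if p 0 then 1 else 0) + count n (p ∘ suc)

count-cong : ∀ n {p q} → (∀ {v} → v < n → p v ≡ q v) → count n p ≡ count n q
count-cong zero    eq = refl
count-cong (suc n) eq =
  cong₂ _+_ (cong (λ b → if b then 1 else 0) (eq z<s)) (count-cong n (eq ∘ s≤s))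

count-none : ∀ n {p} → (∀ {v} → v < n → p v ≡ false) → count n p ≡ 0
count-none zero    none = refl
count-none (suc n) none rewrite none z<s = count-none n (none ∘ s≤s)

count-+ : ∀ m n p → count (m + n) p ≡ count m p + count n (λ v → p (m + v))
count-+ zero    n p = refl
count-+ (suc m) n p = trans (cong (first +_) (count-+ m n (p ∘ suc))) (sym (+-assoc first _ _))
  where
    first : ℕ
    first = if p 0 then 1 else 0

count-monoˡ : ∀ {m n} p → m ≤ n → count m p ≤ count n p
count-monoˡ {m} {n} p m≤n = begin
  count m p                                        ≤⟨ m≤m+n _ _ ⟩
  count m p + count (n ∸ m) (λ v → p (m + v))      ≡⟨ count-+ m (n ∸ m) p ⟨
  count (m + (n ∸ m)) p                            ≡⟨ cong (λ k → count k p) (m+[n∸m]≡n m≤n) ⟩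
  count n p                                        ∎
  where open ≤-Reasoning

count-≡ᵇ : ∀ {n j} → j < n → count n (_≡ᵇ j) ≡ 1
count-≡ᵇ {suc n} {zero}  _         = cong suc (count-none n λ _ → refl)
count-≡ᵇ {suc n} {suc j} (s≤s j<n) = count-≡ᵇ j<n

count-periodic : ∀ t q p → (∀ v → p (t + v) ≡ p v) → count (q * t) p ≡ q * count t p
count-periodic t zero    p periodic = refl
count-periodic t (suc q) p periodic = begin
  count (t + q * t) p                          ≡⟨ count-+ t (q * t) p ⟩
  count t p + count (q * t) (λ v → p (t + v))
    ≡⟨ cong (count t p +_) (count-cong (q * t) λ {v} _ → periodic v) ⟩
  count t p + count (q * t) p                  ≡⟨ cong (count t p +_) (count-periodic t q p periodic) ⟩
  count t p + q * count t p                    ∎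
  where open ≡-Reasoning

count-residue : ∀ t .{{_ : NonZero t}} q {j} → j < t → count (q * t) (λ v → v % t ≡ᵇ j) ≡ q
count-residue t q {j} j<t = begin
  count (q * t) (λ v → v % t ≡ᵇ j)  ≡⟨ count-periodic t q _ (λ v → cong (_≡ᵇ j) (shift v)) ⟩
  q * count t (λ v → v % t ≡ᵇ j)
    ≡⟨ cong (q *_) (count-cong t λ v<t → cong (_≡ᵇ j) (m<n⇒m%n≡m v<t)) ⟩
  q * count t (_≡ᵇ j)               ≡⟨ cong (q *_) (count-≡ᵇ j<t) ⟩
  q * 1                             ≡⟨ *-identityʳ q ⟩
  q                                 ∎
  where
    open ≡-Reasoning
    shift : ∀ v → (t + v) % t ≡ v % t
    shift v = trans (cong (_% t) (+-comm t v)) ([m+n]%n≡m%n v t)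

m%o≡n%o∧m<n⇒m+o≤n : ∀ {m n} o .{{_ : NonZero o}} → m % o ≡ n % o → m < n → m + o ≤ n
m%o≡n%o∧m<n⇒m+o≤n {m} {n} o m%o≡n%o m<n = begin
  m + o                    ≡⟨ cong (_+ o) (m≡m%n+[m/n]*n m o) ⟩
  m % o + m / o * o + o    ≡⟨ +-assoc (m % o) _ o ⟩
  m % o + (m / o * o + o)  ≡⟨ cong (m % o +_) (+-comm (m / o * o) o) ⟩
  m % o + suc (m / o) * o  ≤⟨ +-mono-≤ (≤-reflexive m%o≡n%o) (*-monoˡ-≤ o m/o<n/o) ⟩
  n % o + n / o * o        ≡⟨ m≡m%n+[m/n]*n n o ⟨
  n                        ∎
  where
    open ≤-Reasoning
    m/o<n/o : m / o < n / o
    m/o<n/o with m≤n⇒m<n∨m≡n (/-monoˡ-≤ o (<⇒≤ m<n))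
    ... | inj₁ m/o<n/o = m/o<n/o
    ... | inj₂ m/o≡n/o = contradiction (begin-equality
          m                  ≡⟨ m≡m%n+[m/n]*n m o ⟩
          m % o + m / o * o  ≡⟨ cong₂ (λ r q → r + q * o) m%o≡n%o m/o≡n/o ⟩
          n % o + n / o * o  ≡⟨ m≡m%n+[m/n]*n n o ⟨
          n                  ∎) (<⇒≢ m<n)

spread-residueClass : ∀ {x₁ x₂ x₃ x₄ r} t .{{_ : NonZero t}} → x₁ < x₂ → x₂ < x₃ → x₃ < x₄ →
                      x₁ % t ≡ r → x₂ % t ≡ r → x₃ % t ≡ r → x₄ % t ≡ r → 3 * t ≤ x₄
spread-residueClass {x₁} {x₂} {x₃} {x₄} t x₁<x₂ x₂<x₃ x₃<x₄ r₁ r₂ r₃ r₄ = begin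
  3 * t           ≤⟨ m≤n+m (3 * t) x₁ ⟩
  x₁ + 3 * t      ≡⟨ unfold x₁ t ⟩
  x₁ + t + t + t  ≤⟨ +-monoˡ-≤ t (+-monoˡ-≤ t (gap r₁ r₂ x₁<x₂)) ⟩
  x₂ + t + t      ≤⟨ +-monoˡ-≤ t (gap r₂ r₃ x₂<x₃) ⟩
  x₃ + t          ≤⟨ gap r₃ r₄ x₃<x₄ ⟩
  x₄              ∎
  where
    open ≤-Reasoning
    unfold : ∀ x t → x + 3 * t ≡ x + t + t + t
    unfold = solve-∀
    gap : ∀ {m n r} → m % t ≡ r → n % t ≡ r → m < n → m + t ≤ n
    gap rm rn = m%o≡n%o∧m<n⇒m+o≤n t (trans rm (sym rn))

≡ᵇ-cancelˡ : ∀ m {x y} → (m + x ≡ᵇ m + y) ≡ (x ≡ᵇ y)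
≡ᵇ-cancelˡ zero    = refl
≡ᵇ-cancelˡ (suc m) = ≡ᵇ-cancelˡ m

isYes-≤?-< : ∀ {w n} → w < n → ⌊ suc w ≤? n ⌋ ≡ true
isYes-≤?-< {w} {n} w<n = trans (isYes≗does (suc w ≤? n)) (dec-true (suc w ≤? n) w<n)

isYes-≤?-≥ : ∀ {w n} → n ≤ w → ⌊ suc w ≤? n ⌋ ≡ false
isYes-≤?-≥ {w} {n} n≤w = trans (isYes≗does (suc w ≤? n)) (dec-false (suc w ≤? n) (≤⇒≯ n≤w))

isYes⇒witness : ∀ {A : Set} (a? : Dec A) → ⌊ a? ⌋ ≡ true → A
isYes⇒witness (yes a) _ = a

does-≟ᶠ : ∀ {k} (i j : Fin k) → does (i ≟ᶠ j) ≡ (toℕ i ≡ᵇ toℕ j)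
does-≟ᶠ zero    zero    = refl
does-≟ᶠ zero    (suc j) = refl
does-≟ᶠ (suc i) zero    = refl
does-≟ᶠ (suc i) (suc j) = does-≟ᶠ i j

length-filter-tabulate : ∀ {A : Set} {P : Pred A 0ℓ} (P? : Decidable P) n (g : Fin n → A) (p : ℕ → Bool) →
                         (∀ i → does (P? (g i)) ≡ p (toℕ i)) → length (filter P? (tabulate g)) ≡ count n p
length-filter-tabulate P? zero    g p agree = refl
length-filter-tabulate P? (suc n) g p agree with P? (g zero) | agree zero
... | yes _ | e rewrite sym e = cong suc (length-filter-tabulate P? n (g ∘ suc) (p ∘ suc) (agree ∘ suc))
... | no _  | e rewrite sym e = length-filter-tabulate P? n (g ∘ suc) (p ∘ suc) (agree ∘ suc)

module _ {A : Set} {P Q : Pred A 0ℓ} (P? : Decidable P) (Q? : Decidable Q) (P⊆Q : P ⊆ Q) where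

  length-filter-mono : ∀ xs → length (filter P? xs) ≤ length (filter Q? xs)
  length-filter-mono []       = z≤n
  length-filter-mono (x ∷ xs) with P? x | Q? x
  ... | yes _  | yes _  = s≤s (length-filter-mono xs)
  ... | yes px | no ¬qx = contradiction (P⊆Q px) ¬qx
  ... | no _   | yes _  = m≤n⇒m≤1+n (length-filter-mono xs)
  ... | no _   | no _   = length-filter-mono xs

  length-filter-< : ∀ {x xs} → x ∈ xs → ¬ P x → Q x → length (filter P? xs) < length (filter Q? xs)
  length-filter-< {x} {_ ∷ xs} (here refl) ¬px qx
    rewrite filter-reject P? {xs = xs} ¬px | filter-accept Q? {xs = xs} qx = s≤s (length-filter-mono xs)
  length-filter-< {_} {y ∷ xs} (there x∈xs) ¬px qx with P? y | Q? y
  ... | yes _  | yes _  = s≤s (length-filter-< x∈xs ¬px qx)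
  ... | yes py | no ¬qy = contradiction (P⊆Q py) ¬qy
  ... | no _   | yes _  = m≤n⇒m≤1+n (length-filter-< x∈xs ¬px qx)
  ... | no _   | no _   = length-filter-< x∈xs ¬px qx

anyFunction? : ∀ k {m} {P : (Fin k → Fin m) → Set} → (∀ {f g} → f ≗ g → P f → P g) →
               (∀ f → Dec (P f)) → Dec (∃ P)
anyFunction? zero    P-cong P? with P? (λ ())
... | yes p = yes (_ , p)
... | no ¬p = no λ (f , pf) → ¬p (P-cong (λ ()) pf)
anyFunction? (suc k) P-cong P?
  with any? (λ x → anyFunction? k (λ f≗g → P-cong λ { zero → refl ; (suc i) → f≗g i })
                                  (P? ∘ (x Vector.∷_)))
... | yes (x , g , p) = yes (x Vector.∷ g , p)
... | no ¬p = no λ (f , pf) → ¬p (f zero , f ∘ suc , P-cong (λ { zero → refl ; (suc i) → refl }) pf)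

least-upwardClosed : {P : ℕ → Set} → (∀ s → Dec (P s)) → (∀ {s s′} → s ≤ s′ → P s → P s′) →
                     ∀ {k} → P k → Σ ℕ λ t → P t × t ≤ k × (∀ {s} → P s → t ≤ s)
least-upwardClosed P? upward {zero}  p₀ = 0 , p₀ , z≤n , λ _ → z≤n
least-upwardClosed P? upward {suc k} pk with P? k
... | yes pk′ = let t , pt , t≤k , least = least-upwardClosed P? upward pk′ in t , pt , m≤n⇒m≤1+n t≤k , least
... | no ¬pk  = suc k , pk , ≤-refl , λ {s} ps → case s ≤? k of λ where
      (yes s≤k) → contradiction (upward s≤k ps) ¬pk
      (no s≰k)  → ≰⇒> s≰k

module _ (G : Graph) where

  classSize-cong : ∀ {t} {f g : Coloring G t} → f ≗ g → ∀ i → classSize G f i ≡ classSize G g i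
  classSize-cong {f = f} {g} f≗g i = cong length (filter-≐ (λ v → f v ≟ᶠ i) (λ v → g v ≟ᶠ i)
    ((λ {v} → trans (sym (f≗g v))) , (λ {v} → trans (f≗g v))) (allFin _))

  classDegree-cong : ∀ {t} {f g : Coloring G t} → f ≗ g → ∀ v → classDegree G f v ≡ classDegree G g v
  classDegree-cong {t} {f} {g} f≗g v = cong length (filter-≐ (neighbour? f) (neighbour? g)
      ((λ {u} → subst (λ b → adj G v u ∧ b ≡ true) (sameColor u)) ,
       (λ {u} → subst (λ b → adj G v u ∧ b ≡ true) (sym (sameColor u)))) (allFin _))
    where
      neighbour? : (h : Coloring G t) → Decidable λ u → (adj G v u ∧ ⌊ h u ≟ᶠ h v ⌋) ≡ true
      neighbour? h u = (adj G v u ∧ ⌊ h u ≟ᶠ h v ⌋) Bool.≟ true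
      sameColor : ∀ u → ⌊ f u ≟ᶠ f v ⌋ ≡ ⌊ g u ≟ᶠ g v ⌋
      sameColor u = cong₂ (λ x y → ⌊ x ≟ᶠ y ⌋) (f≗g u) (f≗g v)

  monoCycle-cong : ∀ {t} {f g : Coloring G t} → f ≗ g → MonoCycle G f → MonoCycle G g
  monoCycle-cong f≗g (m , C , c , mono) = m , C , c , λ i → trans (sym (f≗g _)) (mono i)

  equitable? : ∀ {t} (f : Coloring G t) → Dec (Equitable G f)
  equitable? f = all? λ i → all? λ j → classSize G f i ≤? classSize G f j + 1

  hasEqTreeColoring? : (∀ {t} (f : Coloring G t) → Dec (MonoCycle G f)) → ∀ t k → Dec (HasEqTreeColoring G t k)
  hasEqTreeColoring? monoCycle? t k = anyFunction? (order G) respects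
      (λ f → equitable? f ×-dec ¬? (monoCycle? f) ×-dec all? λ v → classDegree G f v ≤? k)
    where
      respects : ∀ {f g : Coloring G t} → f ≗ g →
                 Equitable G f × TreeColoring G k f → Equitable G g × TreeColoring G k g
      respects f≗g (equitable , acyclic , degree≤k) =
        (λ i j → subst₂ (λ x y → x ≤ y + 1) (classSize-cong f≗g i) (classSize-cong f≗g j) (equitable i j)) ,
        (acyclic ∘ monoCycle-cong (sym ∘ f≗g)) ,
        (λ v → subst (_≤ k) (classDegree-cong f≗g v) (degree≤k v))

  strongEq? : ∀ {k b} → (∀ t → Dec (HasEqTreeColoring G t k)) → StrongEq G k b → ∀ s → Dec (StrongEq G k s)
  strongEq? {k} {b} has? strong-b s with allUpTo? (λ t → s ≤? t →-dec has? t) b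
  ... | yes below = yes λ t s≤t → case t <? b of λ where
        (yes t<b) → below t<b s≤t
        (no t≮b)  → strong-b t (≮⇒≥ t≮b)
  ... | no ¬below = no λ strong-s → ¬below λ {t} _ → strong-s t

  strongEqVA-exists : ∀ {k b} → (∀ t → Dec (HasEqTreeColoring G t k)) → 1 ≤ b → StrongEq G k b →
                      Σ ℕ λ t → IsStrongEqVA G k t × t ≤ b
  strongEqVA-exists {k} has? 1≤b strong-b =
    let t , (1≤t , strong-t) , t≤b , least = least-upwardClosed P? upward (1≤b , strong-b)
    in t , (1≤t , strong-t , λ s 1≤s strong-s → least (1≤s , strong-s)) , t≤b
    where
      P? : ∀ s → Dec (1 ≤ s × StrongEq G k s)
      P? s = (1 ≤? s) ×-dec strongEq? has? strong-b s
      upward : ∀ {s s′} → s ≤ s′ → 1 ≤ s × StrongEq G k s → 1 ≤ s′ × StrongEq G k s′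
      upward s≤s′ (1≤s , strong-s) =
        ≤-trans 1≤s s≤s′ , λ t s′≤t → strong-s t (≤-trans s≤s′ s′≤t)

  equitable-between : ∀ {t} {f : Coloring G t} q →
                      (∀ i → q ≤ classSize G f i) → (∀ i → classSize G f i ≤ q + 1) → Equitable G f
  equitable-between q lower upper i j = ≤-trans (upper i) (+-monoˡ-≤ 1 (lower j))

  classDegree<classSize : ∀ {t} (f : Coloring G t) v → classDegree G f v < classSize G f (f v)
  classDegree<classSize f v =
    length-filter-< (λ u → (adj G v u ∧ ⌊ f u ≟ᶠ f v ⌋) Bool.≟ true) (λ u → f u ≟ᶠ f v)
      (λ {u} e → isYes⇒witness (f u ≟ᶠ f v) (∧-conicalʳ _ _ e)) (∈-allFin v)
      (λ e → contradiction (trans (sym (∧-conicalˡ _ _ e)) (irrefl G v)) λ ()) refl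

  classDegree-independent : ∀ {t} {f : Coloring G t} → (∀ u v → f u ≡ f v → adj G u v ≡ false) →
                            ∀ v → classDegree G f v ≡ 0
  classDegree-independent {f = f} independent v =
    cong length (filter-none (λ u → (adj G v u ∧ ⌊ f u ≟ᶠ f v ⌋) Bool.≟ true) {allFin _}
      (All.tabulate λ {u} _ → notNeighbour u))
    where
      notNeighbour : ∀ u → (adj G v u ∧ ⌊ f u ≟ᶠ f v ⌋) ≢ true
      notNeighbour u e = contradiction
        (trans (sym (∧-conicalˡ _ _ e)) (independent v u (sym (isYes⇒witness (f u ≟ᶠ f v) (∧-conicalʳ _ _ e)))))
        λ ()

  coloringFromℕ : ∀ {t} (c : ℕ → ℕ) → (∀ w → c w < t) → Coloring G t
  coloringFromℕ c c<t v = fromℕ< (c<t (toℕ v))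

  classSize-coloringFromℕ : ∀ {t} (c : ℕ → ℕ) (c<t : ∀ w → c w < t) i →
                            classSize G (coloringFromℕ c c<t) i ≡ count (order G) (λ w → c w ≡ᵇ toℕ i)
  classSize-coloringFromℕ c c<t i = length-filter-tabulate _ (order G) (λ v → v) _ λ v →
    trans (does-≟ᶠ (fromℕ< (c<t (toℕ v))) i) (cong (_≡ᵇ toℕ i) (toℕ-fromℕ< (c<t (toℕ v))))

sortPair : ∀ {n} {P : Fin n → Set} {x x′} → x ≢ x′ → P x → P x′ →
           ∃₂ λ u w → toℕ u < toℕ w × P u × P w
sortPair {x = x} {x′} x≢x′ px px′ with <-cmp (toℕ x) (toℕ x′)
... | tri< x<x′ _ _ = x , x′ , x<x′ , px , px′
... | tri≈ _ x≡x′ _ = contradiction (toℕ-injective x≡x′) x≢x′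
... | tri> _ _ x′<x = x′ , x , x′<x , px′ , px

xor-true⇒not : ∀ {x y} → xor x y ≡ true → y ≡ not x
xor-true⇒not {true}  {false} _ = refl
xor-true⇒not {false} {true}  _ = refl

inFirst⇒< : ∀ {a n} {v : Fin n} → inFirst a v ≡ true → toℕ v < a
inFirst⇒< {a} {v = v} _ with suc (toℕ v) ≤? a
... | yes v<a = v<a

¬inFirst⇒≥ : ∀ {a n} {v : Fin n} → inFirst a v ≡ false → a ≤ toℕ v
¬inFirst⇒≥ {a} {v = v} _ with suc (toℕ v) ≤? a
... | no v≮a = ≤-pred (≰⇒> v≮a)

module _ (a b : ℕ) where

  across : ∀ {u v : Fin (a + b)} → inFirst a u ≡ true → inFirst a v ≡ false → adj (K a b) u v ≡ true
  across su sv rewrite su | sv = refl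

  across′ : ∀ {u v : Fin (a + b)} → inFirst a u ≡ true → inFirst a v ≡ false → adj (K a b) v u ≡ true
  across′ {u} {v} su sv = trans (Graph.sym (K a b) v u) (across su sv)

  across≢ : ∀ {u v : Fin (a + b)} → inFirst a u ≡ true → inFirst a v ≡ false → u ≢ v
  across≢ su sv refl = contradiction (trans (sym su) sv) λ ()

  module _ {t} (f : Coloring (K a b) t) where

    Colored : Bool → Fin t → Fin (a + b) → Set
    Colored s c x = inFirst a x ≡ s × f x ≡ c

    Pair : Bool → Fin t → Set
    Pair s c = ∃₂ λ x x′ → x ≢ x′ × Colored s c x × Colored s c x′

    -- A monochromatic cycle of K a b exists iff one color class has two vertices on each side;
    -- unlike MonoCycle, which ranges over all cycle lengths, this is decidable.
    MonoC4 : Set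
    MonoC4 = ∃ λ c → Pair true c × Pair false c

    monoC4 : ∀ s {c} → Pair s c → Pair (not s) c → MonoC4
    monoC4 true  p q = _ , p , q
    monoC4 false p q = _ , q , p

    monoCycle⇒monoC4 : MonoCycle (K a b) f → MonoC4
    monoCycle⇒monoC4 (zero , C , _ , _) = ⊥-elim (not-¬ (sym s₂≡s₀) (xor-true⇒not (close C)))
      where
        open Cycle
        s₂≡s₀ : inFirst a (vtx C (suc (suc zero))) ≡ inFirst a (vtx C zero)
        s₂≡s₀ = trans (xor-true⇒not (step C (suc zero)))
                      (trans (cong not (xor-true⇒not (step C zero))) (not-involutive _))
    monoCycle⇒monoC4 (suc m , C , c , mono) =
      monoC4 (side v₀)
        (vtx C v₀ , vtx C v₂ , distinct (λ ()) , (refl , mono v₀) , (s₂≡s₀ , mono v₂))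
        (vtx C v₁ , vtx C v₃ , distinct (λ ()) , (s₁ , mono v₁) , (trans s₃ (cong not s₂≡s₀) , mono v₃))
      where
        open Cycle
        v₀ v₁ v₂ v₃ : Fin (4 + m)
        v₀ = zero ; v₁ = suc zero ; v₂ = suc (suc zero) ; v₃ = suc (suc (suc zero))
        side : Fin (4 + m) → Bool
        side i = inFirst a (vtx C i)
        distinct : ∀ {i j} → i ≢ j → vtx C i ≢ vtx C j
        distinct i≢j = i≢j ∘ inj C
        s₁ : side v₁ ≡ not (side v₀)
        s₁ = xor-true⇒not (step C zero)
        s₃ : side v₃ ≡ not (side v₂)
        s₃ = xor-true⇒not (step C (suc (suc zero)))
        s₂≡s₀ : side v₂ ≡ side v₀
        s₂≡s₀ = trans (xor-true⇒not (step C (suc zero))) (trans (cong not s₁) (not-involutive _))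

    monoC4⇒monoCycle : MonoC4 → MonoCycle (K a b) f
    monoC4⇒monoCycle (c , (x , x′ , x≢x′ , (sx , fx) , (sx′ , fx′))
                        , (y , y′ , y≢y′ , (sy , fy) , (sy′ , fy′))) =
      1 , record { vtx = vtx ; inj = inj ; step = step ; close = across′ sx sy′ } , c , mono
      where
        vtx : Fin 4 → Fin (a + b)
        vtx zero                   = x
        vtx (suc zero)             = y
        vtx (suc (suc zero))       = x′
        vtx (suc (suc (suc zero))) = y′
        step : ∀ i → adj (K a b) (vtx (inject₁ i)) (vtx (suc i)) ≡ true
        step zero             = across sx sy
        step (suc zero)       = across′ sx′ sy
        step (suc (suc zero)) = across sx′ sy′
        mono : ∀ i → f (vtx i) ≡ c
        mono zero                   = fx
        mono (suc zero)             = fy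
        mono (suc (suc zero))       = fx′
        mono (suc (suc (suc zero))) = fy′
        inj : ∀ {i j} → vtx i ≡ vtx j → i ≡ j
        inj {zero}                 {zero}                 _ = refl
        inj {suc zero}             {suc zero}             _ = refl
        inj {suc (suc zero)}       {suc (suc zero)}       _ = refl
        inj {suc (suc (suc zero))} {suc (suc (suc zero))} _ = refl
        inj {zero}                 {suc (suc zero)}       e = ⊥-elim (x≢x′ e)
        inj {suc (suc zero)}       {zero}                 e = ⊥-elim (x≢x′ (sym e))
        inj {suc zero}             {suc (suc (suc zero))} e = ⊥-elim (y≢y′ e)
        inj {suc (suc (suc zero))} {suc zero}             e = ⊥-elim (y≢y′ (sym e))
        inj {zero}                 {suc zero}             e = ⊥-elim (across≢ sx sy e)
        inj {zero}                 {suc (suc (suc zero))} e = ⊥-elim (across≢ sx sy′ e)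
        inj {suc (suc zero)}       {suc zero}             e = ⊥-elim (across≢ sx′ sy e)
        inj {suc (suc zero)}       {suc (suc (suc zero))} e = ⊥-elim (across≢ sx′ sy′ e)
        inj {suc zero}             {zero}                 e = ⊥-elim (across≢ sx sy (sym e))
        inj {suc (suc (suc zero))} {zero}                 e = ⊥-elim (across≢ sx sy′ (sym e))
        inj {suc zero}             {suc (suc zero)}       e = ⊥-elim (across≢ sx′ sy (sym e))
        inj {suc (suc (suc zero))} {suc (suc zero)}       e = ⊥-elim (across≢ sx′ sy′ (sym e))

    monoC4? : Dec MonoC4
    monoC4? = any? λ c → pair? true c ×-dec pair? false c
      where
        colored? : ∀ s c x → Dec (Colored s c x)
        colored? s c x = (inFirst a x Bool.≟ s) ×-dec (f x ≟ᶠ c)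
        pair? : ∀ s c → Dec (Pair s c)
        pair? s c = any? λ x → any? λ x′ → ¬? (x ≟ᶠ x′) ×-dec colored? s c x ×-dec colored? s c x′

  monoCycle? : ∀ {t} (f : Coloring (K a b) t) → Dec (MonoCycle (K a b) f)
  monoCycle? f = map′ (monoC4⇒monoCycle f) (monoCycle⇒monoC4 f) (monoC4? f)

  sideSeparated-treeColoring : ∀ {t k} {f : Coloring (K a b) t} →
                               (∀ u v → f u ≡ f v → inFirst a u ≡ inFirst a v) → TreeColoring (K a b) k f
  sideSeparated-treeColoring {k = k} {f} separated = acyclic , λ v → subst (_≤ k) (sym (degree≡0 v)) z≤n
    where
      acyclic : ¬ MonoCycle (K a b) f
      acyclic mono with monoCycle⇒monoC4 f mono
      ... | _ , (x , _ , _ , (sx , fx) , _) , (y , _ , _ , (sy , fy) , _) =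
        contradiction (trans (sym sx) (trans (separated x y (trans fx (sym fy))) sy)) λ ()
      degree≡0 : ∀ v → classDegree (K a b) f v ≡ 0
      degree≡0 = classDegree-independent (K a b) λ u v fu≡fv →
        trans (cong (xor (inFirst a u)) (sym (separated u v fu≡fv))) (xor-self _)

module _ (a b t : ℕ) .{{_ : NonZero t}} where

  residueColoring : Coloring (K a b) t
  residueColoring = coloringFromℕ (K a b) (_% t) (λ w → m%n<n w t)

  classSize-residueColoring : ∀ i →
                              classSize (K a b) residueColoring i ≡ count (a + b) (λ w → w % t ≡ᵇ toℕ i)
  classSize-residueColoring = classSize-coloringFromℕ (K a b) (_% t) (λ w → m%n<n w t)

  residueColoring-equitable : Equitable (K a b) residueColoring
  residueColoring-equitable = equitable-between (K a b) q
    (λ i → begin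
      q                                    ≡⟨ count-residue t q (toℕ<n i) ⟨
      count (q * t) (residue i)            ≤⟨ count-monoˡ (residue i) (m/n*n≤m (a + b) t) ⟩
      count (a + b) (residue i)            ≡⟨ classSize-residueColoring i ⟨
      classSize (K a b) residueColoring i  ∎)
    (λ i → begin
      classSize (K a b) residueColoring i  ≡⟨ classSize-residueColoring i ⟩
      count (a + b) (residue i)            ≤⟨ count-monoˡ (residue i) (<⇒≤ a+b<[1+q]t) ⟩
      count (suc q * t) (residue i)        ≡⟨ count-residue t (suc q) (toℕ<n i) ⟩
      suc q                                ≡⟨ +-comm 1 q ⟩
      q + 1                                ∎)
    where
      open ≤-Reasoning
      q : ℕ
      q = (a + b) / t
      residue : Fin t → ℕ → Bool
      residue i w = w % t ≡ᵇ toℕ i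
      a+b<[1+q]t : a + b < suc q * t
      a+b<[1+q]t = begin-strict
        a + b                ≡⟨ m≡m%n+[m/n]*n (a + b) t ⟩
        (a + b) % t + q * t  <⟨ +-monoˡ-< (q * t) (m%n<n (a + b) t) ⟩
        t + q * t            ∎

  module _ (a+b≤3t : a + b ≤ 3 * t) where

    classSize-residueColoring≤3 : ∀ i → classSize (K a b) residueColoring i ≤ 3
    classSize-residueColoring≤3 i = begin
      classSize (K a b) residueColoring i   ≡⟨ classSize-residueColoring i ⟩
      count (a + b) (λ w → w % t ≡ᵇ toℕ i)  ≤⟨ count-monoˡ _ a+b≤3t ⟩
      count (3 * t) (λ w → w % t ≡ᵇ toℕ i)  ≡⟨ count-residue t 3 (toℕ<n i) ⟩
      3                                     ∎
      where open ≤-Reasoning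

    residueColoring-noMonoC4 : ¬ MonoC4 a b residueColoring
    residueColoring-noMonoC4 (c , (x , x′ , x≢x′ , cx , cx′) , (y , y′ , y≢y′ , cy , cy′))
      with sortPair x≢x′ cx cx′ | sortPair y≢y′ cy cy′
    ... | u₁ , w₁ , u₁<w₁ , (_ , fu₁) , (s₁ , fw₁) | u₂ , w₂ , u₂<w₂ , (s₂ , fu₂) , (_ , fw₂) =
      <⇒≱ (<-≤-trans (toℕ<n w₂) a+b≤3t)
        (spread-residueClass t u₁<w₁ (<-≤-trans (inFirst⇒< s₁) (¬inFirst⇒≥ s₂)) u₂<w₂
          (residue fu₁) (residue fw₁) (residue fu₂) (residue fw₂))
      where
        residue : ∀ {v} → residueColoring v ≡ c → toℕ v % t ≡ toℕ c
        residue {v} e = trans (sym (toℕ-fromℕ< (m%n<n (toℕ v) t))) (cong toℕ e)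

    residueColoring-hasEq : HasEqTreeColoring (K a b) t 2
    residueColoring-hasEq = residueColoring , residueColoring-equitable ,
      residueColoring-noMonoC4 ∘ monoCycle⇒monoC4 a b residueColoring ,
      λ v → ≤-pred (≤-trans (classDegree<classSize (K a b) residueColoring v) (classSize-residueColoring≤3 _))

module _ (m : ℕ) .{{_ : NonZero m}} where

  sideColor : Bool → ℕ → ℕ
  sideColor true  w = w % m
  sideColor false w = m + (w ∸ 3 * m) % m

  sideColor< : ∀ s w → sideColor s w < m + m
  sideColor< true  w = <-≤-trans (m%n<n w m) (m≤m+n m m)
  sideColor< false w = +-monoʳ-< m (m%n<n (w ∸ 3 * m) m)

  sideColor-injectiveˡ : ∀ s s′ {w w′} → sideColor s w ≡ sideColor s′ w′ → s ≡ s′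
  sideColor-injectiveˡ true  true  _ = refl
  sideColor-injectiveˡ false false _ = refl
  sideColor-injectiveˡ true  false e = contradiction e (<⇒≢ (<-≤-trans (m%n<n _ m) (m≤m+n m _)))
  sideColor-injectiveˡ false true  e = contradiction (sym e) (<⇒≢ (<-≤-trans (m%n<n _ m) (m≤m+n m _)))

  splitColor : ℕ → ℕ
  splitColor w = sideColor ⌊ suc w ≤? 3 * m ⌋ w

  splitColor< : ∀ w → splitColor w < m + m
  splitColor< w = sideColor< ⌊ suc w ≤? 3 * m ⌋ w

  splitColoring : Coloring (K (3 * m) (3 * m + 1)) (m + m)
  splitColoring = coloringFromℕ (K (3 * m) (3 * m + 1)) splitColor splitColor<

  splitColoring-separated : ∀ u v → splitColoring u ≡ splitColoring v → inFirst (3 * m) u ≡ inFirst (3 * m) v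
  splitColoring-separated u v e = sideColor-injectiveˡ _ _
    (trans (sym (toℕ-fromℕ< (splitColor< (toℕ u)))) (trans (cong toℕ e) (toℕ-fromℕ< (splitColor< (toℕ v)))))

  classSize-splitColoring : ∀ i → classSize (K (3 * m) (3 * m + 1)) splitColoring i ≡
                            count (3 * m) (λ w → w % m ≡ᵇ toℕ i) +
                            count (3 * m + 1) (λ w → m + w % m ≡ᵇ toℕ i)
  classSize-splitColoring i = begin
    classSize (K (3 * m) (3 * m + 1)) splitColoring i
      ≡⟨ classSize-coloringFromℕ (K (3 * m) (3 * m + 1)) splitColor splitColor< i ⟩
    count (3 * m + (3 * m + 1)) isColor
      ≡⟨ count-+ (3 * m) (3 * m + 1) isColor ⟩
    count (3 * m) isColor + count (3 * m + 1) (λ w → isColor (3 * m + w))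
      ≡⟨ cong₂ _+_ (count-cong (3 * m) λ w<3m → cong (λ s → sideColor s _ ≡ᵇ toℕ i) (isYes-≤?-< w<3m))
                   (count-cong (3 * m + 1) λ {w} _ → cong (λ s → sideColor s (3 * m + w) ≡ᵇ toℕ i)
                                                          (isYes-≤?-≥ (m≤m+n (3 * m) w))) ⟩
    count (3 * m) (λ w → w % m ≡ᵇ toℕ i) +
    count (3 * m + 1) (λ w → m + (3 * m + w ∸ 3 * m) % m ≡ᵇ toℕ i)
      ≡⟨ cong (count (3 * m) (λ w → w % m ≡ᵇ toℕ i) +_) (count-cong (3 * m + 1) λ {w} _ →
           cong (λ x → m + x % m ≡ᵇ toℕ i) (m+n∸m≡n (3 * m) w)) ⟩
    count (3 * m) (λ w → w % m ≡ᵇ toℕ i) +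
    count (3 * m + 1) (λ w → m + w % m ≡ᵇ toℕ i)
      ∎
    where
      open ≡-Reasoning
      isColor : ℕ → Bool
      isColor w = splitColor w ≡ᵇ toℕ i

  classSize-splitColoring-between : ∀ i → 3 ≤ classSize (K (3 * m) (3 * m + 1)) splitColoring i ×
                                          classSize (K (3 * m) (3 * m + 1)) splitColoring i ≤ 3 + 1
  classSize-splitColoring-between i with toℕ i <? m
  ... | yes i<m = subst (λ s → 3 ≤ s × s ≤ 3 + 1) (sym size≡3) (≤-refl , m≤m+n 3 1)
    where
      size≡3 : classSize (K (3 * m) (3 * m + 1)) splitColoring i ≡ 3
      size≡3 = trans (classSize-splitColoring i) (cong₂ _+_ (count-residue m 3 i<m)
        (count-none (3 * m + 1) λ {w} _ → dec-false (m + w % m ≟ toℕ i) (>⇒≢ (<-≤-trans i<m (m≤m+n m _)))))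
  ... | no i≮m = subst (λ s → 3 ≤ s × s ≤ 3 + 1) (sym size≡) (lower , upper)
    where
      open ≤-Reasoning
      j : ℕ
      j = toℕ i ∸ m
      residue-j : ℕ → Bool
      residue-j w = w % m ≡ᵇ j
      m+j≡i : m + j ≡ toℕ i
      m+j≡i = m+[n∸m]≡n (≮⇒≥ i≮m)
      j<m : j < m
      j<m = +-cancelˡ-< m _ _ (subst (_< m + m) (sym m+j≡i) (toℕ<n i))
      size≡ : classSize (K (3 * m) (3 * m + 1)) splitColoring i ≡ count (3 * m + 1) residue-j
      size≡ = trans (classSize-splitColoring i) (cong₂ _+_
        (count-none (3 * m) λ {w} _ →
          dec-false (w % m ≟ toℕ i) (<⇒≢ (<-≤-trans (m%n<n w m) (≮⇒≥ i≮m))))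
        (count-cong (3 * m + 1) λ {w} _ → trans (cong (m + w % m ≡ᵇ_) (sym m+j≡i)) (≡ᵇ-cancelˡ m)))
      lower : 3 ≤ count (3 * m + 1) residue-j
      lower = begin
        3                            ≡⟨ count-residue m 3 j<m ⟨
        count (3 * m) residue-j      ≤⟨ count-monoˡ residue-j (m≤m+n (3 * m) 1) ⟩
        count (3 * m + 1) residue-j  ∎
      upper : count (3 * m + 1) residue-j ≤ 3 + 1
      upper = begin
        count (3 * m + 1) residue-j  ≤⟨ count-monoˡ residue-j (+-monoʳ-≤ (3 * m) (>-nonZero⁻¹ m)) ⟩
        count (3 * m + m) residue-j  ≡⟨ cong (λ k → count k residue-j) (+-comm (3 * m) m) ⟩
        count (4 * m) residue-j      ≡⟨ count-residue m 4 j<m ⟩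
        4                            ∎

  splitColoring-hasEq : HasEqTreeColoring (K (3 * m) (3 * m + 1)) (m + m) 2
  splitColoring-hasEq = splitColoring ,
    equitable-between (K (3 * m) (3 * m + 1)) {f = splitColoring} 3
      (proj₁ ∘ classSize-splitColoring-between) (proj₂ ∘ classSize-splitColoring-between) ,
    sideSeparated-treeColoring (3 * m) (3 * m + 1) splitColoring-separated

bound-positive : ∀ n ℓ → 1 ≤ ℓ → ℓ ≤ n → 1 ≤ bound n ℓ
bound-positive n ℓ 1≤ℓ ℓ≤n = ≤-trans (m≥n⇒m/n>0 3≤n+ℓ+1) (m≤m+n _ _)
  where
    3≤n+ℓ+1 : 3 ≤ n + ℓ + 1
    3≤n+ℓ+1 = +-monoˡ-≤ 1 (+-mono-≤ (≤-trans 1≤ℓ ℓ≤n) 1≤ℓ)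

within-bound : ∀ n ℓ t M R → n + ℓ + 1 ≡ R + M * 3 → 2 * M ≤ t → 2 * R ≤ ℓ + 2 →
               n + (n + ℓ) ≤ 3 * t
within-bound n ℓ t M R n+ℓ+1≡R+3M 2M≤t 2R≤ℓ+2 = ≤-trans (+-cancelʳ-≤ (ℓ + 2) _ _ (begin
  n + (n + ℓ) + (ℓ + 2)      ≡⟨ double n ℓ ⟩
  (n + ℓ + 1) + (n + ℓ + 1)  ≡⟨ cong₂ _+_ n+ℓ+1≡R+3M n+ℓ+1≡R+3M ⟩
  (R + M * 3) + (R + M * 3)  ≡⟨ regroup R M ⟩
  2 * R + 3 * (2 * M)        ≤⟨ +-monoˡ-≤ (3 * (2 * M)) 2R≤ℓ+2 ⟩
  ℓ + 2 + 3 * (2 * M)        ≡⟨ +-comm (ℓ + 2) _ ⟩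
  3 * (2 * M) + (ℓ + 2)      ∎)) (*-monoʳ-≤ 3 2M≤t)
  where
    open ≤-Reasoning
    double : ∀ n ℓ → n + (n + ℓ) + (ℓ + 2) ≡ (n + ℓ + 1) + (n + ℓ + 1)
    double = solve-∀
    regroup : ∀ R M → (R + M * 3) + (R + M * 3) ≡ 2 * R + 3 * (2 * M)
    regroup = solve-∀

beyond-bound : ∀ n ℓ t M R → n + ℓ + 1 ≡ R + M * 3 → R < 3 → 1 ≤ ℓ → 2 * M ≤ t →
               3 * t < n + (n + ℓ) → n ≡ 3 * M × ℓ ≡ 1 × t ≡ M + M
beyond-bound n (suc (suc k)) t M R eq R<3 _ 2M≤t 3t<A = contradiction
  (within-bound n (suc (suc k)) t M R eq 2M≤t (≤-trans (*-monoʳ-≤ 2 (≤-pred R<3)) (s≤s (s≤s (m≤n+m 2 k)))))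
  (<⇒≱ 3t<A)
beyond-bound n 1 t M 0 eq _ _ 2M≤t 3t<A =
  contradiction (within-bound n 1 t M 0 eq 2M≤t z≤n) (<⇒≱ 3t<A)
beyond-bound n 1 t M 1 eq _ _ 2M≤t 3t<A =
  contradiction (within-bound n 1 t M 1 eq 2M≤t (s≤s (s≤s z≤n))) (<⇒≱ 3t<A)
beyond-bound n 1 t M 2 eq _ _ 2M≤t 3t<A = n≡3M , refl , t≡M+M
  where
    n≡3M : n ≡ 3 * M
    n≡3M = trans (+-cancelˡ-≡ 2 n (M * 3) (trans (+-comm 2 n) (trans (sym (+-assoc n 1 1)) eq))) (*-comm M 3)
    odd : ∀ M → 3 * M + (3 * M + 1) ≡ suc (3 * (2 * M))
    odd = solve-∀
    3t≤6M : 3 * t ≤ 3 * (2 * M)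
    3t≤6M = ≤-pred (≤-trans 3t<A (≤-reflexive (trans (cong (λ k → k + (k + 1)) n≡3M) (odd M))))
    t≡M+M : t ≡ M + M
    t≡M+M = trans (*-cancelˡ-≡ t (2 * M) 3 (≤-antisym 3t≤6M (*-monoʳ-≤ 3 2M≤t)))
                  (cong (M +_) (+-identityʳ M))
beyond-bound n 1 t M (suc (suc (suc _))) _ (s≤s (s≤s (s≤s ()))) _ _ _

bound-cover : ∀ n ℓ t → 1 ≤ ℓ → bound n ℓ ≤ t →
              n + (n + ℓ) ≤ 3 * t ⊎ Σ ℕ λ M → n ≡ 3 * M × ℓ ≡ 1 × t ≡ M + M
bound-cover n ℓ t 1≤ℓ bound≤t with n + (n + ℓ) ≤? 3 * t
... | yes fits = inj₁ fits
... | no ¬fits = inj₂ (M , beyond-bound n ℓ t M ((n + ℓ + 1) % 3)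
                             (m≡m%n+[m/n]*n (n + ℓ + 1) 3) (m%n<n (n + ℓ + 1) 3) 1≤ℓ bound≤t (≰⇒> ¬fits))
  where
    M : ℕ
    M = (n + ℓ + 1) / 3

strongEq-bound : ∀ n ℓ → 1 ≤ ℓ → ℓ ≤ n → StrongEq (K n (n + ℓ)) 2 (bound n ℓ)
strongEq-bound n ℓ 1≤ℓ ℓ≤n t bound≤t with bound-cover n ℓ t 1≤ℓ bound≤t
... | inj₁ fits =
  residueColoring-hasEq n (n + ℓ) t {{>-nonZero (≤-trans (bound-positive n ℓ 1≤ℓ ℓ≤n) bound≤t)}} fits
... | inj₂ (zero  , refl , refl , refl) = contradiction ℓ≤n λ ()
... | inj₂ (suc M , refl , refl , refl) = splitColoring-hasEq (suc M)

K₂,₃-noEqTreeColoring-1 : ¬ HasEqTreeColoring (K 2 3) 1 2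
K₂,₃-noEqTreeColoring-1 (f , _ , acyclic , _) =
  acyclic (monoC4⇒monoCycle 2 3 f (zero , (x₀ , x₁ , (λ ()) , (refl , only _) , (refl , only _))
                                          , (y₀ , y₁ , (λ ()) , (refl , only _) , (refl , only _))))
  where
    x₀ x₁ y₀ y₁ : Fin 5
    x₀ = zero ; x₁ = suc zero ; y₀ = suc (suc zero) ; y₁ = suc (suc (suc zero))
    only : (i : Fin 1) → i ≡ zero
    only zero = refl

theorem2p1 : ((n ℓ : ℕ) → 1 ≤ ℓ → ℓ ≤ n →
                  Σ ℕ λ t → IsStrongEqVA (K n (n + ℓ)) 2 t × t ≤ bound n ℓ)
               × (Σ ℕ λ n → Σ ℕ λ ℓ → 1 ≤ ℓ × ℓ ≤ n × IsStrongEqVA (K n (n + ℓ)) 2 (bound n ℓ))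
theorem2p1 = upper , (2 , 1 , ≤-refl , s≤s z≤n , sharp)
  where
    upper : (n ℓ : ℕ) → 1 ≤ ℓ → ℓ ≤ n → Σ ℕ λ t → IsStrongEqVA (K n (n + ℓ)) 2 t × t ≤ bound n ℓ
    upper n ℓ 1≤ℓ ℓ≤n =
      strongEqVA-exists (K n (n + ℓ)) (λ t → hasEqTreeColoring? (K n (n + ℓ)) (monoCycle? n (n + ℓ)) t 2)
        (bound-positive n ℓ 1≤ℓ ℓ≤n) (strongEq-bound n ℓ 1≤ℓ ℓ≤n)
    sharp : IsStrongEqVA (K 2 3) 2 2
    sharp = s≤s z≤n , strongEq-bound 2 1 ≤-refl (s≤s z≤n) , λ where
      1             _ strong-1 → contradiction (strong-1 1 ≤-refl) K₂,₃-noEqTreeColoring-1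
      (suc (suc _)) _ _        → s≤s (s≤s z≤n)
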